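{- For every positive integer $k$, there exist a finite simple undirected graph $G$ and an orientation $\vec{G}$ of $G$ such that $$k \geq \operatorname{adim}(G) \geq \operatorname{bdim}(G) \quad\text{and}\quad \operatorname{adim}(\vec{G}) \geq \operatorname{bdim}(\vec{G}) \geq 2^k.$$
   Context: An orientation $\vec{G}$ of $G$ is the directed graph obtained by assigning a direction to each edge of $G$. For a graph (undirected, or directed), $d(u,v)$ is the length of a shortest path (respectively, shortest directed path) from $u$ to $v$, or $\infty$ if none exists; for a positive integer $k$, $d_k(u,v) := \min(d(u,v),k+1)$. A function $f : V \to \mathbb{Z}_{\geq 0}$ is a resolving broadcast if for any distinct vertices $x,y$ there is $z$ with $f(z)>0$ and $d_{f(z)}(z,x)\neq d_{f(z)}(z,y)$. The broadcast dimension $\operatorname{bdim}$ is the minimum of $\sum_v f(v)$ over all resolving broadcasts $f$. An adjacency resolving set is a set $A$ of vertices such that for any distinct $x,y$ there is $z\in A$ with $d_1(z,x)\neq d_1(z,y)$; the adjacency dimension $\operatorname{adim}$ is the minimum cardinality of such a set. -}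

module Defs where

open import Data.Nat using (ℕ; zero; suc; _≤_; _<_)
open import Data.Fin using (Fin)
open import Data.Fin.Subset using (Subset; _∈_; ∣_∣)
open import Data.Bool using (Bool; true; false)
open import Data.List using (tabulate)
open import Data.Nat.ListAction using (sum)
open import Data.Empty using (⊥)
open import Data.Product using (Σ; _×_; ∃; ∃-syntax; _,_)
open import Data.Sum using (_⊎_)
open import Relation.Nullary using (¬_)
open import Relation.Binary.PropositionalEquality using (_≡_; _≢_)

Digraph : ℕ → Set
Digraph n = Fin n → Fin n → Bool

-- A finite simple undirected graph on Fin n: a symmetric, irreflexive
-- adjacency relation. Its distances are those of the symmetric digraph `adj`.
record SimpleGraph (n : ℕ) : Set where
  field
    adj     : Digraph n
    sym     : ∀ u v → adj u v ≡ adj v u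
    irrefl  : ∀ u → adj u u ≡ false
open SimpleGraph public

IsOrientation : ∀ {n} → SimpleGraph n → Digraph n → Set
IsOrientation {n} G D =
  (∀ u v → D u v ≡ true → adj G u v ≡ true) ×
  (∀ u v → adj G u v ≡ true → (D u v ≡ true) ⊎ (D v u ≡ true)) ×
  (∀ u v → D u v ≡ true → D v u ≡ true → ⊥)

-- Directed walks of a given length (shortest walk length = shortest path length).
data Walk {n : ℕ} (E : Digraph n) : Fin n → Fin n → ℕ → Set where
  here : ∀ {u} → Walk E u u 0
  step : ∀ {u w v ℓ} → E u w ≡ true → Walk E w v ℓ → Walk E u v (suc ℓ)

-- TruncDist E k u v m  means  m = d_k(u,v) = min(d(u,v), k+1).
TruncDist : ∀ {n} → Digraph n → ℕ → Fin n → Fin n → ℕ → Set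
TruncDist E k u v m =
  (m ≤ k × Walk E u v m × (∀ j → j < m → ¬ Walk E u v j)) ⊎
  (m ≡ suc k × (∀ j → j ≤ k → ¬ Walk E u v j))

IsResolvingBroadcast : ∀ {n} → Digraph n → (Fin n → ℕ) → Set
IsResolvingBroadcast {n} E f =
  ∀ (x y : Fin n) → x ≢ y →
    ∃[ z ] (0 < f z × ∃[ a ] ∃[ b ]
      (TruncDist E (f z) z x a × TruncDist E (f z) z y b × a ≢ b))

cost : ∀ {n} → (Fin n → ℕ) → ℕ
cost f = sum (tabulate f)

IsAdjResolving : ∀ {n} → Digraph n → Subset n → Set
IsAdjResolving {n} E A =
  ∀ (x y : Fin n) → x ≢ y →
    ∃[ z ] (z ∈ A × ∃[ a ] ∃[ b ]
      (TruncDist E 1 z x a × TruncDist E 1 z y b × a ≢ b))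

IsBdim : ∀ {n} → Digraph n → ℕ → Set
IsBdim {n} E m =
  (∃[ f ] (IsResolvingBroadcast E f × cost f ≡ m)) ×
  (∀ (f : Fin n → ℕ) → IsResolvingBroadcast E f → m ≤ cost f)

IsAdim : ∀ {n} → Digraph n → ℕ → Set
IsAdim {n} E m =
  (∃[ A ] (IsAdjResolving E A × ∣ A ∣ ≡ m)) ×
  (∀ (A : Subset n) → IsAdjResolving E A → m ≤ ∣ A ∣)

module Submission where

-- Take k landmarks u₀ … u_{k-1} and one vertex for every subset S of them,
-- adjacent to u_j exactly when j ∈ S.  The landmarks form an adjacency resolving set, so
-- adim G ≤ k, and bdim ≤ adim always holds because the indicator of a resolving set is a
-- resolving broadcast.  G is the underlying graph of a layered digraph: u_j has layer (class) j,
-- S in the layer of its least missing element (the full set in layer 0), there is an arc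
-- v → w when layer v < layer w and v "contains" layer w (landmarks contain everything), and
-- the full set is a source pointing to every vertex.  Two vertices of the same layer then
-- have the same in-neighbours, hence the same truncated distance from every other vertex, so
-- a resolving broadcast vanishes on at most one vertex per layer and costs at least
-- (k + 2^k) - k = 2^k.

open import Defs hiding (sym)
open import Data.Bool using (Bool; true; false; _∧_; _∨_; not; if_then_else_)
import Data.Bool as Bool
open import Data.Bool.Properties using (∨-comm; ¬-not)
open import Data.Empty using (⊥; ⊥-elim)
open import Data.Fin
  using (Fin; zero; suc; toℕ; fromℕ<; _↑ˡ_; _↑ʳ_; splitAt; punchOut; finToFun; funToFin; combine)
open import Data.Fin.Properties
  using (_≟_; any?; all?; ¬Fin0; ¬∀⟶∃¬; suc-injective; toℕ-injective; toℕ-fromℕ<; punchOut-injective;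
         splitAt-↑ˡ; splitAt⁻¹-↑ˡ; splitAt⁻¹-↑ʳ; funToFin-finToFin; finToFun-funToFin; 2↔Bool)
open import Data.Fin.Subset using (Subset; _∈_; ∣_∣; ⊤) renaming (⊥ to ∅)
open import Data.Fin.Subset.Properties using (_∈?_; ∈⊤; ∣⊥∣≡0; anySubset?)
open import Data.List using (tabulate)
open import Data.List.Properties using (tabulate-cong)
open import Data.Nat
  using (ℕ; zero; suc; _+_; _^_; _≤_; _<_; _<ᵇ_; z≤n; s≤s; s≤s⁻¹; _≤?_; _<?_; NonZero)
open import Data.Nat.Induction using (<-rec)
open import Data.Nat.ListAction using (sum)
open import Data.Nat.Properties
  using (≤-refl; ≤-reflexive; ≤-trans; ≤-antisym; <⇒≤; ≮⇒≥; <-irrefl; <-asym;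
         m≤m+n; m≤n+m; m≤n⇒m≤1+n;
         +-suc; +-monoʳ-≤; +-cancelˡ-≤; <ᵇ-reflects-<; anyUpTo?; module ≤-Reasoning)
  renaming (_≟_ to _≟ℕ_)
open import Data.Product using (Σ; _×_; ∃; ∃-syntax; _,_; proj₂)
open import Data.Sum using (_⊎_; inj₁; inj₂; [_,_]′)
open import Data.Vec using (_∷_; []; _++_; lookup)
open import Data.Vec.Properties using ([]=⇒lookup)
open import Data.Vec.Base using (here; there)
open import Function using (_∘_; id)
open import Function.Bundles using (Inverse)
open import Relation.Nullary using (¬_; Dec; yes; no)
open import Relation.Nullary.Decidable using (map′; _×-dec_; _→-dec_; ¬?)
open import Relation.Nullary.Reflects using (ofʸ; ofⁿ)
open import Relation.Binary.PropositionalEquality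
  using (_≡_; _≢_; refl; sym; trans; cong; cong₂; subst)

true≢false : true ≢ false
true≢false ()

least : {P : ℕ → Set} → (∀ n → Dec (P n)) → ∀ {c} → P c →
        ∃[ m ] (m ≤ c × P m × (∀ n → n < m → ¬ P n))
least {P} P? {c} = <-rec Least search c
  where
  Least : ℕ → Set
  Least c = P c → ∃[ m ] (m ≤ c × P m × (∀ n → n < m → ¬ P n))
  search : ∀ c → (∀ {c′} → c′ < c → Least c′) → Least c
  search c smaller Pc with anyUpTo? P? c
  ... | no none = c , ≤-refl , Pc , λ n n<c Pn → none (n , n<c , Pn)
  ... | yes (c′ , c′<c , Pc′) with smaller c′<c Pc′
  ...   | m , m≤c′ , Pm , minimal = m , ≤-trans m≤c′ (<⇒≤ c′<c) , Pm , minimal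

module _ {n : ℕ} (E : Digraph n) where

  walk? : ∀ u v ℓ → Dec (Walk E u v ℓ)
  walk? u v zero with u ≟ v
  ... | yes refl = yes here
  ... | no u≢v = no λ { here → u≢v refl }
  walk? u v (suc ℓ) =
    map′ (λ (w , e , p) → step e p) (λ { (step e p) → _ , e , p })
         (any? λ w → (E u w Bool.≟ true) ×-dec walk? w v ℓ)

  truncDist : ∀ r u v → ∃ (TruncDist E r u v)
  truncDist r u v with anyUpTo? (walk? u v) (suc r)
  ... | no none = suc r , inj₂ (refl , λ j j≤r w → none (j , s≤s j≤r , w))
  ... | yes (j , j<1+r , w) with least (walk? u v) w
  ...   | m , m≤j , wm , minimal = m , inj₁ (≤-trans m≤j (s≤s⁻¹ j<1+r) , wm , minimal)

  NoFarther : Fin n → Fin n → Fin n → Set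
  NoFarther z y x = ∀ {ℓ} → Walk E z x ℓ → ∃[ ℓ′ ] (ℓ′ ≤ ℓ × Walk E z y ℓ′)

  truncDist-≤-suc : ∀ {r z x a} → TruncDist E r z x a → a ≤ suc r
  truncDist-≤-suc (inj₁ (a≤r , _)) = m≤n⇒m≤1+n a≤r
  truncDist-≤-suc (inj₂ (refl , _)) = ≤-refl

  truncDist-mono : ∀ {r z x y a b} → NoFarther z y x →
                   TruncDist E r z x a → TruncDist E r z y b → b ≤ a
  truncDist-mono shorten (inj₂ (refl , _)) dy = truncDist-≤-suc dy
  truncDist-mono shorten (inj₁ (a≤r , wa , _)) dy with shorten wa
  ... | ℓ , ℓ≤a , w with dy
  ...   | inj₁ (_ , _ , minimal) = ≤-trans (≮⇒≥ λ ℓ<b → minimal ℓ ℓ<b w) ℓ≤a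
  ...   | inj₂ (_ , none) = ⊥-elim (none ℓ (≤-trans ℓ≤a a≤r) w)

  truncDist-unique : ∀ {r z x a b} → TruncDist E r z x a → TruncDist E r z x b → a ≡ b
  truncDist-unique da db = ≤-antisym (truncDist-mono same db da) (truncDist-mono same da db)
    where
    same : ∀ {z x} → NoFarther z x x
    same w = _ , ≤-refl , w

  truncDist-self : ∀ {r u} → TruncDist E r u u 0
  truncDist-self = inj₁ (z≤n , here , λ _ ())

  walk-zero : ∀ {u v} → Walk E u v 0 → u ≡ v
  walk-zero here = refl

  truncDist-zero : ∀ {r u v} → TruncDist E r u v 0 → u ≡ v
  truncDist-zero (inj₁ (_ , w , _)) = walk-zero w

  truncDist-one : ∀ {z x} → z ≢ x → TruncDist E 1 z x (if E z x then 1 else 2)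
  truncDist-one {z} {x} z≢x with E z x in e
  ... | true = inj₁ (≤-refl , step e here , λ { zero _ w → z≢x (walk-zero w) ; (suc _) (s≤s ()) _ })
  ... | false = inj₂ (refl , λ { zero _ w → z≢x (walk-zero w)
                               ; (suc zero) _ (step e′ here) → true≢false (trans (sym e′) e)
                               ; (suc (suc _)) (s≤s ()) _ })

  Separates : ℕ → Fin n → Fin n → Fin n → Set
  Separates r z x y = ∃[ a ] ∃[ b ] (TruncDist E r z x a × TruncDist E r z y b × a ≢ b)

  separates? : ∀ r z x y → Dec (Separates r z x y)
  separates? r z x y with truncDist r z x | truncDist r z y
  ... | a , da | b , db =
    map′ (λ a≢b → a , b , da , db , a≢b)
         (λ (a′ , b′ , da′ , db′ , a′≢b′) a≡b →
            a′≢b′ (trans (truncDist-unique da′ da) (trans a≡b (truncDist-unique db db′))))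
         (¬? (a ≟ℕ b))

  separates-sym : ∀ {r z x y} → Separates r z x y → Separates r z y x
  separates-sym (a , b , da , db , a≢b) = b , a , db , da , a≢b ∘ sym

  separates-self : ∀ r {x y} → x ≢ y → Separates r x x y
  separates-self r {x} {y} x≢y with truncDist r x y
  ... | b , db = 0 , b , truncDist-self , db ,
                 λ 0≡b → x≢y (truncDist-zero (subst (TruncDist E r x y) (sym 0≡b) db))

  separates-by-arc : ∀ {z x y} → z ≢ x → z ≢ y → E z x ≢ E z y → Separates 1 z x y
  separates-by-arc z≢x z≢y arcs≢ =
    _ , _ , truncDist-one z≢x , truncDist-one z≢y , arcs≢ ∘ if-injective _ _
    where
    if-injective : ∀ b c → (if b then 1 else 2) ≡ (if c then 1 else 2) → b ≡ c
    if-injective true true _ = refl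
    if-injective false false _ = refl

  isAdjResolving? : ∀ A → Dec (IsAdjResolving E A)
  isAdjResolving? A =
    all? λ x → all? λ y → ¬? (x ≟ y) →-dec any? λ z → (z ∈? A) ×-dec separates? 1 z x y

  isResolvingBroadcast? : ∀ f → Dec (IsResolvingBroadcast E f)
  isResolvingBroadcast? f =
    all? λ x → all? λ y → ¬? (x ≟ y) →-dec any? λ z → (0 <? f z) ×-dec separates? (f z) z x y

  resolvingBroadcast-cong : ∀ {f g} → (∀ i → f i ≡ g i) →
                            IsResolvingBroadcast E f → IsResolvingBroadcast E g
  resolvingBroadcast-cong f≗g rb x y x≢y with rb x y x≢y
  ... | z , 0<fz , separated =
    z , subst (0 <_) (f≗g z) 0<fz , subst (λ r → Separates r z x y) (f≗g z) separated

∃-minimum : {A : Set} (P : A → Set) (size : A → ℕ) →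
            (∀ c → Dec (∃[ a ] (P a × size a ≤ c))) → ∀ {a₀} → P a₀ →
            ∃[ m ] ((∃[ a ] (P a × size a ≡ m)) × (∀ a → P a → m ≤ size a))
∃-minimum P size bounded? {a₀} Pa₀ with least bounded? (a₀ , Pa₀ , ≤-refl)
... | m , _ , (a , Pa , a≤m) , minimal =
  m , (a , Pa , ≤-antisym a≤m (≮⇒≥ (below a Pa))) , λ a′ Pa′ → ≮⇒≥ (below a′ Pa′)
  where
  below : ∀ a → P a → ¬ size a < m
  below a Pa a<m = minimal (size a) a<m (a , Pa , ≤-refl)

cost-cong : ∀ {n} {f g : Fin n → ℕ} → (∀ i → f i ≡ g i) → cost f ≡ cost g
cost-cong f≗g = cong sum (tabulate-cong f≗g)

≤-cost : ∀ {n} (f : Fin n → ℕ) i → f i ≤ cost f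
≤-cost f zero = m≤m+n _ _
≤-cost f (suc i) = ≤-trans (≤-cost (f ∘ suc) i) (m≤n+m _ (f zero))

adim-exists : ∀ {n} (E : Digraph n) → ∃ (IsAdim E)
adim-exists E =
  ∃-minimum (IsAdjResolving E) ∣_∣
    (λ c → anySubset? λ A → isAdjResolving? E A ×-dec (∣ A ∣ ≤? c))
    (λ x y x≢y → x , ∈⊤ , separates-self E 1 x≢y)

bdim-exists : ∀ {n} (E : Digraph n) → ∃ (IsBdim E)
bdim-exists {n} E =
  ∃-minimum (IsResolvingBroadcast E) cost bounded?
    (λ x y x≢y → x , s≤s z≤n , separates-self E 1 x≢y)
  where
  -- a broadcast of cost at most c takes values in Fin (suc c), and there are finitely many such
  bounded? : ∀ c → Dec (∃[ f ] (IsResolvingBroadcast E f × cost f ≤ c))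
  bounded? c =
    map′ (λ (g , rb , g≤c) → values g , rb , g≤c) encode
         (any? λ g → isResolvingBroadcast? E (values g) ×-dec (cost (values g) ≤? c))
    where
    values : Fin (suc c ^ n) → Fin n → ℕ
    values g = toℕ ∘ finToFun g
    encode : ∃[ f ] (IsResolvingBroadcast E f × cost f ≤ c) →
             ∃[ g ] (IsResolvingBroadcast E (values g) × cost (values g) ≤ c)
    encode (f , rb , f≤c) =
      funToFin f′ , resolvingBroadcast-cong E f≗ rb , subst (_≤ c) (cost-cong f≗) f≤c
      where
      f′ : Fin n → Fin (suc c)
      f′ i = fromℕ< (s≤s (≤-trans (≤-cost f i) f≤c))
      f≗ : ∀ i → f i ≡ values (funToFin f′) i
      f≗ i = trans (sym (toℕ-fromℕ< _)) (cong toℕ (sym (finToFun-funToFin f′ i)))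

indicator : ∀ {n} → Subset n → Fin n → ℕ
indicator A i = if lookup A i then 1 else 0

cost-indicator : ∀ {n} (A : Subset n) → cost (indicator A) ≡ ∣ A ∣
cost-indicator [] = refl
cost-indicator (true ∷ A) = cong suc (cost-indicator A)
cost-indicator (false ∷ A) = cost-indicator A

indicator-resolving : ∀ {n} (E : Digraph n) {A} →
                      IsAdjResolving E A → IsResolvingBroadcast E (indicator A)
indicator-resolving E {A} resolving x y x≢y with resolving x y x≢y
... | z , z∈A , separated =
  z , subst (0 <_) (sym in-A) (s≤s z≤n) , subst (λ r → Separates E r z x y) (sym in-A) separated
  where
  in-A : indicator A z ≡ 1
  in-A = cong (if_then 1 else 0) ([]=⇒lookup z∈A)

dimensions : ∀ {n} (E : Digraph n) → ∃[ a ] ∃[ b ] (IsAdim E a × IsBdim E b × b ≤ a)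
dimensions E with adim-exists E | bdim-exists E
... | a , adim@((A , resolving , refl) , _) | b , bdim@(_ , minimal) =
  a , b , adim , bdim ,
  subst (b ≤_) (cost-indicator A) (minimal (indicator A) (indicator-resolving E resolving))

module _ {n : ℕ} (E : Digraph n) where

  InTwins : Fin n → Fin n → Set
  InTwins x y = ∀ w → w ≢ x → w ≢ y → E w x ≡ E w y

  inTwins-sym : ∀ {x y} → InTwins x y → InTwins y x
  inTwins-sym twins w w≢y w≢x = sym (twins w w≢x w≢y)

  walk-to-inTwin : ∀ {x y z ℓ} → InTwins x y → Walk E z x ℓ →
                   z ≡ x ⊎ ∃[ ℓ′ ] (ℓ′ ≤ ℓ × Walk E z y ℓ′)
  walk-to-inTwin twins here = inj₁ refl
  walk-to-inTwin {x} {y} {z} twins (step e p) with walk-to-inTwin twins p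
  ... | inj₂ (ℓ′ , ℓ′≤ℓ , q) = inj₂ (suc ℓ′ , s≤s ℓ′≤ℓ , step e q)
  ... | inj₁ refl with z ≟ x | z ≟ y
  ...   | yes z≡x | _ = inj₁ z≡x
  ...   | no _ | yes refl = inj₂ (0 , z≤n , here)
  ...   | no z≢x | no z≢y = inj₂ (1 , s≤s z≤n , step (trans (sym (twins z z≢x z≢y)) e) here)

  inTwins-equidistant : ∀ {r x y z a b} → InTwins x y → z ≢ x → z ≢ y →
                        TruncDist E r z x a → TruncDist E r z y b → a ≡ b
  inTwins-equidistant twins z≢x z≢y dx dy =
    ≤-antisym (truncDist-mono E (shorten (inTwins-sym twins) z≢y) dy dx)
              (truncDist-mono E (shorten twins z≢x) dx dy)
    where
    shorten : ∀ {x y z} → InTwins x y → z ≢ x → NoFarther E z y x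
    shorten twins z≢x w = [ ⊥-elim ∘ z≢x , id ]′ (walk-to-inTwin twins w)

  inTwins-not-both-zero : ∀ {f x y} → InTwins x y → IsResolvingBroadcast E f →
                            x ≢ y → f x ≡ 0 → f y ≡ 0 → ⊥
  inTwins-not-both-zero {f} twins rb x≢y fx≡0 fy≡0 with rb _ _ x≢y
  ... | z , 0<fz , a , b , dx , dy , a≢b =
    a≢b (inTwins-equidistant twins (z≢ fx≡0) (z≢ fy≡0) dx dy)
    where
    z≢ : ∀ {v} → f v ≡ 0 → z ≢ v
    z≢ fv≡0 refl = <-irrefl (sym fv≡0) 0<fz

injective-on-zeros⇒n≤k+cost : ∀ {n k} (f : Fin n → ℕ) (class : ∀ x → f x ≡ 0 → Fin k) →
  (∀ {x y} (fx : f x ≡ 0) (fy : f y ≡ 0) → class x fx ≡ class y fy → x ≡ y) → n ≤ k + cost f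
injective-on-zeros⇒n≤k+cost {zero} f class injective = z≤n
injective-on-zeros⇒n≤k+cost {suc n} {k} f class injective with f zero in f0≡
... | suc a = begin
  suc n                        ≤⟨ s≤s (injective-on-zeros⇒n≤k+cost _ _ injective′) ⟩
  suc (k + cost (f ∘ suc))     ≡⟨ sym (+-suc k _) ⟩
  k + suc (cost (f ∘ suc))     ≤⟨ +-monoʳ-≤ k (s≤s (m≤n+m _ a)) ⟩
  k + (suc a + cost (f ∘ suc)) ∎
  where
  open ≤-Reasoning
  injective′ : ∀ {x y} (fx : f (suc x) ≡ 0) (fy : f (suc y) ≡ 0) →
               class (suc x) fx ≡ class (suc y) fy → x ≡ y
  injective′ fx fy = suc-injective ∘ injective fx fy
injective-on-zeros⇒n≤k+cost {suc n} {zero} f class injective | zero =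
  ⊥-elim (¬Fin0 (class zero f0≡))
injective-on-zeros⇒n≤k+cost {suc n} {suc k} f class injective | zero =
  s≤s (injective-on-zeros⇒n≤k+cost (f ∘ suc) class′ injective′)
  where
  class₀≢ : ∀ {x} (fx : f (suc x) ≡ 0) → class zero f0≡ ≢ class (suc x) fx
  class₀≢ fx eq with injective f0≡ fx eq
  ... | ()
  class′ : ∀ x → f (suc x) ≡ 0 → Fin k
  class′ x fx = punchOut (class₀≢ fx)
  injective′ : ∀ {x y} (fx : f (suc x) ≡ 0) (fy : f (suc y) ≡ 0) →
               class′ x fx ≡ class′ y fy → x ≡ y
  injective′ fx fy = suc-injective ∘ injective fx fy ∘ punchOut-injective (class₀≢ fx) (class₀≢ fy)

module _ {n : ℕ} (D : Digraph n) (irreflexive : ∀ u → D u u ≡ false) where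

  symmetrise : SimpleGraph n
  symmetrise = record
    { adj = λ u v → D u v ∨ D v u
    ; sym = λ u v → ∨-comm (D u v) (D v u)
    ; irrefl = λ u → cong₂ _∨_ (irreflexive u) (irreflexive u)
    }

  symmetrise-orientation : (∀ {u v} → D u v ≡ true → D v u ≡ true → ⊥) → IsOrientation symmetrise D
  symmetrise-orientation asymmetric =
    (λ u v uv → cong (_∨ D v u) uv) , one-direction , λ u v → asymmetric
    where
    one-direction : ∀ u v → D u v ∨ D v u ≡ true → D u v ≡ true ⊎ D v u ≡ true
    one-direction u v e with D u v
    ... | true = inj₁ refl
    ... | false = inj₂ e

module Layered {n k : ℕ} (class : Fin n → Fin k) (bit : Fin n → Fin k → Bool) (source : Fin n → Bool)
  (source-unique : ∀ {u v} → source u ≡ true → source v ≡ true → u ≡ v)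
  (source-bottom : ∀ {u v} → source u ≡ true → ¬ toℕ (class v) < toℕ (class u)) where

  arc : Digraph n
  arc v w = (source v ∧ not (source w)) ∨ ((toℕ (class v) <ᵇ toℕ (class w)) ∧ bit v (class w))

  arc⇒ : ∀ {v w} → arc v w ≡ true →
         (source v ≡ true × source w ≡ false) ⊎ toℕ (class v) < toℕ (class w)
  arc⇒ {v} {w} e
    with source v | source w | toℕ (class v) <ᵇ toℕ (class w)
       | <ᵇ-reflects-< (toℕ (class v)) (toℕ (class w))
  ... | true | false | _ | _ = inj₁ (refl , refl)
  ... | _ | _ | true | ofʸ v<w = inj₂ v<w
  arc⇒ () | true | true | false | _
  arc⇒ () | false | _ | false | _

  arc-irreflexive : ∀ v → arc v v ≡ false
  arc-irreflexive v =
    ¬-not λ e → [ (λ (sv , ¬sv) → true≢false (trans (sym sv) ¬sv)) , <-irrefl refl ]′ (arc⇒ e)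

  arc-asymmetric : ∀ {v w} → arc v w ≡ true → arc w v ≡ true → ⊥
  arc-asymmetric vw wv with arc⇒ vw | arc⇒ wv
  ... | inj₁ (_ , ¬sw) | inj₁ (sw , _) = true≢false (trans (sym sw) ¬sw)
  ... | inj₁ (sv , _) | inj₂ w<v = source-bottom sv w<v
  ... | inj₂ v<w | inj₁ (sw , _) = source-bottom sw v<w
  ... | inj₂ v<w | inj₂ w<v = <-asym v<w w<v

  arc-inTwins : ∀ {x y} → class x ≡ class y → InTwins arc x y
  arc-inTwins {x} {y} cx≡cy w w≢x w≢y rewrite cx≡cy
    with source x in sx | source y in sy | source w in sw
  ... | true | true | _ = refl
  ... | false | false | _ = refl
  ... | _ | _ | false = refl
  ... | true | false | true = ⊥-elim (w≢x (source-unique sw sx))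
  ... | false | true | true = ⊥-elim (w≢y (source-unique sw sy))

  graph : SimpleGraph n
  graph = symmetrise arc arc-irreflexive

  arc-orients-graph : IsOrientation graph arc
  arc-orients-graph = symmetrise-orientation arc arc-irreflexive arc-asymmetric

  n≤k+cost : ∀ f → IsResolvingBroadcast arc f → n ≤ k + cost f
  n≤k+cost f rb = injective-on-zeros⇒n≤k+cost f (λ x _ → class x) zeros-injective
    where
    zeros-injective : ∀ {x y} → f x ≡ 0 → f y ≡ 0 → class x ≡ class y → x ≡ y
    zeros-injective {x} {y} fx≡0 fy≡0 cx≡cy with x ≟ y
    ... | yes x≡y = x≡y
    ... | no x≢y = ⊥-elim (inTwins-not-both-zero arc (arc-inTwins cx≡cy) rb x≢y fx≡0 fy≡0)

data FirstFalse {k : ℕ} (b : Fin k → Bool) : Set where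
  all-true : (∀ i → b i ≡ true) → FirstFalse b
  false-at : ∀ j → b j ≡ false → (∀ i → toℕ i < toℕ j → b i ≡ true) → FirstFalse b

firstFalse : ∀ {k} (b : Fin k → Bool) → FirstFalse b
firstFalse {zero} b = all-true λ ()
firstFalse {suc k} b with b zero in b₀ | firstFalse (b ∘ suc)
... | false | _ = false-at zero b₀ λ _ ()
... | true | all-true rest = all-true λ { zero → b₀ ; (suc i) → rest i }
... | true | false-at j bj below =
  false-at (suc j) bj λ { zero _ → b₀ ; (suc i) i<j → below i (s≤s⁻¹ i<j) }

funToFin-cong : ∀ {m n} {f g : Fin m → Fin n} → (∀ i → f i ≡ g i) → funToFin f ≡ funToFin g
funToFin-cong {zero} _ = refl
funToFin-cong {suc m} f≗g = cong₂ combine (f≗g zero) (funToFin-cong (f≗g ∘ suc))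

∣⊤++∅∣ : ∀ m n → ∣ ⊤ {m} ++ ∅ {n} ∣ ≡ m
∣⊤++∅∣ zero n = ∣⊥∣≡0 n
∣⊤++∅∣ (suc m) n = cong suc (∣⊤++∅∣ m n)

↑ˡ∈⊤++ : ∀ {m n} (j : Fin m) (A : Subset n) → (j ↑ˡ n) ∈ (⊤ ++ A)
↑ˡ∈⊤++ zero A = here
↑ˡ∈⊤++ (suc j) A = there (↑ˡ∈⊤++ j A)

module Construction (m : ℕ) where

  k : ℕ
  k = suc m

  -- Vertex j ↑ˡ 2 ^ k is the landmark u_j; vertex k ↑ʳ s is the subset whose indicator
  -- function is bits s.

  bits : Fin (2 ^ k) → Fin k → Bool
  bits s j = Inverse.to 2↔Bool (finToFun s j)

  bits-injective : ∀ {s t} → (∀ j → bits s j ≡ bits t j) → s ≡ t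
  bits-injective {s} {t} same =
    trans (sym (funToFin-finToFin {k} {2} s))
          (trans (funToFin-cong (to-injective ∘ same)) (funToFin-finToFin {k} {2} t))
    where
    open Inverse 2↔Bool using (to; from; strictlyInverseʳ)
    to-injective : ∀ {a b} → to a ≡ to b → a ≡ b
    to-injective {a} {b} e = trans (sym (strictlyInverseʳ a)) (trans (cong from e) (strictlyInverseʳ b))

  classOf : ∀ {b : Fin k → Bool} → FirstFalse b → Fin k
  classOf (all-true _) = zero
  classOf (false-at j _ _) = j

  isAllTrue : ∀ {b : Fin k → Bool} → FirstFalse b → Bool
  isAllTrue (all-true _) = true
  isAllTrue (false-at _ _ _) = false

  N : ℕ
  N = k + 2 ^ k

  class : Fin N → Fin k
  class u = [ id , (λ s → classOf (firstFalse (bits s))) ]′ (splitAt k u)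

  bit : Fin N → Fin k → Bool
  bit u = [ (λ _ _ → true) , bits ]′ (splitAt k u)

  source : Fin N → Bool
  source u = [ (λ _ → false) , (λ s → isAllTrue (firstFalse (bits s))) ]′ (splitAt k u)

  source⇒all-true : ∀ {u} → source u ≡ true → ∃[ s ] (k ↑ʳ s ≡ u × ∀ j → bits s j ≡ true)
  source⇒all-true {u} su with splitAt k u in eq
  source⇒all-true () | inj₁ _
  ... | inj₂ s with firstFalse (bits s)
  ...   | all-true all = s , splitAt⁻¹-↑ʳ eq , all
  source⇒all-true () | inj₂ s | false-at _ _ _

  source-unique : ∀ {u v} → source u ≡ true → source v ≡ true → u ≡ v
  source-unique {u} {v} su sv with source⇒all-true {u} su | source⇒all-true {v} sv
  ... | s , refl , s-true | t , refl , t-true =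
    cong (k ↑ʳ_) (bits-injective λ j → trans (s-true j) (sym (t-true j)))

  source-bottom : ∀ {u v} → source u ≡ true → ¬ toℕ (class v) < toℕ (class u)
  source-bottom {u} su with splitAt k u
  source-bottom () | inj₁ _
  ... | inj₂ s with firstFalse (bits s)
  ...   | all-true _ = λ ()
  source-bottom () | inj₂ s | false-at _ _ _

  open Layered class bit source (λ {u} {v} → source-unique {u} {v}) (λ {u} {v} → source-bottom {u} {v})
    public

  landmark-adjacency : ∀ j {x s} → splitAt k x ≡ inj₂ s → adj graph (j ↑ˡ 2 ^ k) x ≡ bits s j
  landmark-adjacency j {x} {s} x≡s rewrite splitAt-↑ˡ k j (2 ^ k) | x≡s with firstFalse (bits s)
  ... | all-true all = sym (all j)
  ... | false-at c bc below
      with toℕ j <ᵇ toℕ c | <ᵇ-reflects-< (toℕ j) (toℕ c)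
         | toℕ c <ᵇ toℕ j | <ᵇ-reflects-< (toℕ c) (toℕ j)
  ...   | true | ofʸ j<c | _ | _ = sym (below j j<c)
  ...   | false | _ | true | _ = refl
  ...   | false | ofⁿ j≮c | false | ofⁿ c≮j =
    sym (trans (cong (bits s) (toℕ-injective (≤-antisym (≮⇒≥ c≮j) (≮⇒≥ j≮c)))) bc)

  landmarks : Subset N
  landmarks = ⊤ {k} ++ ∅ {2 ^ k}

  ∣landmarks∣≡k : ∣ landmarks ∣ ≡ k
  ∣landmarks∣≡k = ∣⊤++∅∣ k (2 ^ k)

  landmark∈ : ∀ {u j} → splitAt k u ≡ inj₁ j → u ∈ landmarks
  landmark∈ {j = j} u≡ = subst (_∈ landmarks) (splitAt⁻¹-↑ˡ u≡) (↑ˡ∈⊤++ j (∅ {2 ^ k}))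

  landmarks-resolve : IsAdjResolving (adj graph) landmarks
  landmarks-resolve x y x≢y with splitAt k x in x≡ | splitAt k y in y≡
  ... | inj₁ j | _ = x , landmark∈ x≡ , separates-self _ 1 x≢y
  ... | inj₂ _ | inj₁ j = y , landmark∈ y≡ , separates-sym _ (separates-self _ 1 (x≢y ∘ sym))
  ... | inj₂ s | inj₂ t with ¬∀⟶∃¬ k _ (λ j → bits s j Bool.≟ bits t j) (s≢t ∘ bits-injective)
    where
    s≢t : s ≢ t
    s≢t refl = x≢y (trans (sym (splitAt⁻¹-↑ʳ x≡)) (splitAt⁻¹-↑ʳ y≡))
  ...   | j , bits≢ =
    j ↑ˡ 2 ^ k , landmark∈ (splitAt-↑ˡ k j (2 ^ k)) ,
    separates-by-arc _ (landmark≢ x≡) (landmark≢ y≡)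
      λ e → bits≢ (trans (sym (landmark-adjacency j {x} x≡)) (trans e (landmark-adjacency j {y} y≡)))
    where
    landmark≢ : ∀ {u r} → splitAt k u ≡ inj₂ r → j ↑ˡ 2 ^ k ≢ u
    landmark≢ u≡ refl with trans (sym (splitAt-↑ˡ k j (2 ^ k))) u≡
    ... | ()

  2^k≤cost : ∀ f → IsResolvingBroadcast arc f → 2 ^ k ≤ cost f
  2^k≤cost f rb = +-cancelˡ-≤ k _ _ (n≤k+cost f rb)

dimension-bounds : ∀ {n} (G : SimpleGraph n) (D : Digraph n) {k c} →
  (∃[ A ] (IsAdjResolving (adj G) A × ∣ A ∣ ≤ k)) → (∀ f → IsResolvingBroadcast D f → c ≤ cost f) →
  ∃[ aG ] ∃[ bG ] ∃[ aD ] ∃[ bD ]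
    (IsAdim (adj G) aG × IsBdim (adj G) bG × IsAdim D aD × IsBdim D bD ×
     aG ≤ k × bG ≤ aG × bD ≤ aD × c ≤ bD)
dimension-bounds G D (A , resolving , A≤k) lower with dimensions (adj G) | dimensions D
... | aG , bG , adimG , bdimG , bG≤aG | aD , bD , adimD , bdimD@((f , rb , refl) , _) , bD≤aD =
  aG , bG , aD , bD , adimG , bdimG , adimD , bdimD ,
  ≤-trans (proj₂ adimG A resolving) A≤k , bG≤aG , bD≤aD , lower f rb

open Construction
  using (N; graph; arc; arc-orients-graph; landmarks; ∣landmarks∣≡k; landmarks-resolve; 2^k≤cost)

theorem5p3 : (k : ℕ) → .{{_ : NonZero k}} →
    ∃[ n ] Σ (SimpleGraph n) λ G → Σ (Digraph n) λ D → IsOrientation G D ×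
      ∃[ aG ] ∃[ bG ] ∃[ aD ] ∃[ bD ]
        (IsAdim (adj G) aG × IsBdim (adj G) bG × IsAdim D aD × IsBdim D bD ×
         aG ≤ k × bG ≤ aG × bD ≤ aD × 2 ^ k ≤ bD)
theorem5p3 (suc m) =
  N m , graph m , arc m , arc-orients-graph m ,
  dimension-bounds (graph m) (arc m)
    (landmarks m , landmarks-resolve m , ≤-reflexive (∣landmarks∣≡k m))
    (2^k≤cost m)
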